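{- Let $M$ be an abelian group, $P \subseteq M$ a pixel set, and $B_1, B_2, B_3 \subseteq M$ structuring elements. If $B_1 \subseteq_{S,P,+} B_2$ and $B_2 \subseteq_{S,P,+} B_3$, then $B_1 \subseteq_{S,P,+} B_3$; likewise, if $B_1 \subseteq_{S,P,- } B_2$ and $B_2 \subseteq_{S,P,- } B_3$, then $B_1 \subseteq_{S,P,- } B_3$. Consequently, $B_1 \subseteq_{S,P} B_2$ and $B_2 \subseteq_{S,P} B_3$ imply $B_1 \subseteq_{S,P} B_3$.
   Context: A structuring element is a finite set $B$ with $0 \in B \subseteq M$. For $x \in P$, $B(x;P,+) = \{ b \in B : x + b \in P\}$, $B(x;P,-) = \{ b \in B : x - b \in P\}$. $B_1 \subseteq_{S,P,+} B_2$: $B_1 \subseteq B_2$ and for every $x \in P$, $b_2 \in B_2(x;P,+)$ there is $b_1 \in B_1(x;P,+)$ with $B_1 + (b_2 - b_1) \subseteq B_2$. $B_1 \subseteq_{S,P,- } B_2$: $B_1 \subseteq B_2$ and for every $x \in P$, $b_2 \in B_2(x;P,-)$ there is $b_1 \in B_1(x;P,-)$ with $B_1 + (b_2 - b_1) \subseteq B_2$. $B_1 \subseteq_{S,P} B_2$: both hold. $A + v = \{a + v : a \in A\}$. -}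

module Defs where

open import Level using (Level; _⊔_; suc)
open import Algebra.Bundles using (AbelianGroup)
open import Data.List using (List)
open import Data.List.Relation.Unary.Any using (Any)
open import Data.Product using (_×_; Σ-syntax)
open import Relation.Unary using (Pred)

module _ {c ℓ : Level} (M : AbelianGroup c ℓ) where
  open AbelianGroup M renaming (Carrier to A)

  _⊖_ : A → A → A
  x ⊖ y = x ∙ (y ⁻¹)

  -- a subset of M given by a finite list; membership is up to the group's equality
  _∈ₗ_ : A → List A → Set (c ⊔ ℓ)
  a ∈ₗ B = Any (a ≈_) B

  record PixelSet (p : Level) : Set (c ⊔ ℓ ⊔ suc p) where
    field
      pix     : Pred A p
      respect : ∀ {x y} → x ≈ y → pix x → pix y
  open PixelSet public

  record StructuringElement : Set (c ⊔ ℓ) where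
    field
      elems   : List A
      zero∈   : ε ∈ₗ elems
  open StructuringElement public

  _∈SE_ : A → StructuringElement → Set (c ⊔ ℓ)
  a ∈SE B = a ∈ₗ elems B

  _⊆SE_ : StructuringElement → StructuringElement → Set (c ⊔ ℓ)
  B₁ ⊆SE B₂ = ∀ a → a ∈SE B₁ → a ∈SE B₂

  translate⊆ : StructuringElement → A → StructuringElement → Set (c ⊔ ℓ)
  translate⊆ B v C = ∀ a → a ∈SE B → (a ∙ v) ∈SE C

  inB+ : ∀ {p} → PixelSet p → StructuringElement → A → A → Set (c ⊔ ℓ ⊔ p)
  inB+ P B x b = b ∈SE B × pix P (x ∙ b)

  inB- : ∀ {p} → PixelSet p → StructuringElement → A → A → Set (c ⊔ ℓ ⊔ p)
  inB- P B x b = b ∈SE B × pix P (x ⊖ b)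

  ⊆S+ : ∀ {p} → PixelSet p → StructuringElement → StructuringElement → Set (c ⊔ ℓ ⊔ p)
  ⊆S+ P B₁ B₂ = B₁ ⊆SE B₂ ×
    (∀ x → pix P x → ∀ b₂ → inB+ P B₂ x b₂ →
       Σ[ b₁ ∈ A ] (inB+ P B₁ x b₁ × translate⊆ B₁ (b₂ ⊖ b₁) B₂))

  ⊆S- : ∀ {p} → PixelSet p → StructuringElement → StructuringElement → Set (c ⊔ ℓ ⊔ p)
  ⊆S- P B₁ B₂ = B₁ ⊆SE B₂ ×
    (∀ x → pix P x → ∀ b₂ → inB- P B₂ x b₂ →
       Σ[ b₁ ∈ A ] (inB- P B₁ x b₁ × translate⊆ B₁ (b₂ ⊖ b₁) B₂))

  ⊆S : ∀ {p} → PixelSet p → StructuringElement → StructuringElement → Set (c ⊔ ℓ ⊔ p)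
  ⊆S P B₁ B₂ = ⊆S+ P B₁ B₂ × ⊆S- P B₁ B₂

-- Chain the witnesses: b₃ ∈ B₃(x) is reached from some b₂ ∈ B₂(x), which is reached from some
-- b₁ ∈ B₁(x); the translations compose since (b₂ − b₁) + (b₃ − b₂) = b₃ − b₁, so
-- B₁ + (b₃ − b₁) = (B₁ + (b₂ − b₁)) + (b₃ − b₂) ⊆ B₂ + (b₃ − b₂) ⊆ B₃.
module Submission where

open import Defs
open import Level using (Level; _⊔_)
open import Algebra.Bundles using (AbelianGroup)
open import Data.Product using (_×_; _,_; Σ-syntax)
import Data.List.Relation.Unary.Any as Any
import Relation.Binary.Reasoning.Setoid as SetoidReasoning

module _ {c ℓ : Level} (M : AbelianGroup c ℓ) where
  open AbelianGroup M renaming (Carrier to A)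

  ⊖-telescope : ∀ b₁ b₂ b₃ → (_⊖_ M b₂ b₁ ∙ _⊖_ M b₃ b₂) ≈ _⊖_ M b₃ b₁
  ⊖-telescope b₁ b₂ b₃ = begin
    (b₂ ∙ b₁ ⁻¹) ∙ (b₃ ∙ b₂ ⁻¹)  ≈⟨ comm _ _ ⟩
    (b₃ ∙ b₂ ⁻¹) ∙ (b₂ ∙ b₁ ⁻¹)  ≈⟨ assoc _ _ _ ⟩
    b₃ ∙ (b₂ ⁻¹ ∙ (b₂ ∙ b₁ ⁻¹))  ≈⟨ ∙-congˡ (sym (assoc _ _ _)) ⟩
    b₃ ∙ ((b₂ ⁻¹ ∙ b₂) ∙ b₁ ⁻¹)  ≈⟨ ∙-congˡ (∙-congʳ (inverseˡ _)) ⟩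
    b₃ ∙ (ε ∙ b₁ ⁻¹)             ≈⟨ ∙-congˡ (identityˡ _) ⟩
    b₃ ∙ b₁ ⁻¹                   ∎
    where open SetoidReasoning setoid

  ∈SE-resp-≈ : ∀ B {a b} → a ≈ b → _∈SE_ M a B → _∈SE_ M b B
  ∈SE-resp-≈ B a≈b = Any.map (trans (sym a≈b))

  ⊆SE-trans : ∀ B₁ B₂ B₃ → _⊆SE_ M B₁ B₂ → _⊆SE_ M B₂ B₃ → _⊆SE_ M B₁ B₃
  ⊆SE-trans B₁ B₂ B₃ B₁⊆B₂ B₂⊆B₃ a a∈B₁ = B₂⊆B₃ a (B₁⊆B₂ a a∈B₁)

  translate⊆-trans : ∀ B₁ B₂ B₃ {u v} →
    translate⊆ M B₁ u B₂ → translate⊆ M B₂ v B₃ → translate⊆ M B₁ (u ∙ v) B₃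
  translate⊆-trans B₁ B₂ B₃ B₁+u⊆B₂ B₂+v⊆B₃ a a∈B₁ =
    ∈SE-resp-≈ B₃ (assoc _ _ _) (B₂+v⊆B₃ _ (B₁+u⊆B₂ a a∈B₁))

  translate⊆-⊖-trans : ∀ B₁ B₂ B₃ b₁ b₂ b₃ →
    translate⊆ M B₁ (_⊖_ M b₂ b₁) B₂ → translate⊆ M B₂ (_⊖_ M b₃ b₂) B₃ →
    translate⊆ M B₁ (_⊖_ M b₃ b₁) B₃
  translate⊆-⊖-trans B₁ B₂ B₃ b₁ b₂ b₃ B₁⊆B₂ B₂⊆B₃ a a∈B₁ =
    ∈SE-resp-≈ B₃ (∙-congˡ (⊖-telescope b₁ b₂ b₃)) (translate⊆-trans B₁ B₂ B₃ B₁⊆B₂ B₂⊆B₃ a a∈B₁)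

  -- ⊆S+ and ⊆S- are the instances with admissibility x + b ∈ P and x − b ∈ P respectively.
  ⊆S-via : ∀ {p q} (P : PixelSet M p) →
    (StructuringElement M → A → A → Set q) →
    StructuringElement M → StructuringElement M → Set (c ⊔ ℓ ⊔ p ⊔ q)
  ⊆S-via P admissible B₁ B₂ = _⊆SE_ M B₁ B₂ ×
    (∀ x → pix P x → ∀ b₂ → admissible B₂ x b₂ →
       Σ[ b₁ ∈ A ] (admissible B₁ x b₁ × translate⊆ M B₁ (_⊖_ M b₂ b₁) B₂))

  ⊆S-via-trans : ∀ {p q} (P : PixelSet M p) (admissible : StructuringElement M → A → A → Set q)
    (B₁ B₂ B₃ : StructuringElement M) → ⊆S-via P admissible B₁ B₂ → ⊆S-via P admissible B₂ B₃ →
    ⊆S-via P admissible B₁ B₃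
  ⊆S-via-trans P admissible B₁ B₂ B₃ (B₁⊆B₂ , reach₁₂) (B₂⊆B₃ , reach₂₃) =
    ⊆SE-trans B₁ B₂ B₃ B₁⊆B₂ B₂⊆B₃ , λ x x∈P b₃ b₃-adm →
      let (b₂ , b₂-adm , B₂⊆B₃-shifted) = reach₂₃ x x∈P b₃ b₃-adm
          (b₁ , b₁-adm , B₁⊆B₂-shifted) = reach₁₂ x x∈P b₂ b₂-adm
      in b₁ , b₁-adm , translate⊆-⊖-trans B₁ B₂ B₃ b₁ b₂ b₃ B₁⊆B₂-shifted B₂⊆B₃-shifted

  ⊆S+-trans : ∀ {p} (P : PixelSet M p) B₁ B₂ B₃ →
    ⊆S+ M P B₁ B₂ → ⊆S+ M P B₂ B₃ → ⊆S+ M P B₁ B₃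
  ⊆S+-trans P = ⊆S-via-trans P (inB+ M P)

  ⊆S--trans : ∀ {p} (P : PixelSet M p) B₁ B₂ B₃ →
    ⊆S- M P B₁ B₂ → ⊆S- M P B₂ B₃ → ⊆S- M P B₁ B₃
  ⊆S--trans P = ⊆S-via-trans P (inB- M P)

proposition4 : ∀ {c ℓ p : Level} (M : AbelianGroup c ℓ) (P : PixelSet M p)
    (B₁ B₂ B₃ : StructuringElement M) →
    ((⊆S+ M P B₁ B₂ → ⊆S+ M P B₂ B₃ → ⊆S+ M P B₁ B₃) ×
     (⊆S- M P B₁ B₂ → ⊆S- M P B₂ B₃ → ⊆S- M P B₁ B₃)) ×
    (⊆S M P B₁ B₂ → ⊆S M P B₂ B₃ → ⊆S M P B₁ B₃)
proposition4 M P B₁ B₂ B₃ =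
  (⊆S+-trans M P B₁ B₂ B₃ , ⊆S--trans M P B₁ B₂ B₃) ,
  λ { (B₁⊆₊B₂ , B₁⊆₋B₂) (B₂⊆₊B₃ , B₂⊆₋B₃) →
        ⊆S+-trans M P B₁ B₂ B₃ B₁⊆₊B₂ B₂⊆₊B₃ , ⊆S--trans M P B₁ B₂ B₃ B₁⊆₋B₂ B₂⊆₋B₃ }
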